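{- Let $G=(V,E)$ be a finite simple undirected graph, let $C \subseteq V$ be a clique of $G$, let $p$ be a nonnegative integer, and let $x \in \{0,1\}^{E(C)}$, where $x_e = 1$ means that the edge $e \in E(C)$ is blocked (removed) and $x_e = 0$ means it is kept. Suppose that for every permutation $\overrightarrow{C}$ of the vertices of $C$ there exist values $z_{u,\overrightarrow{C}} \in \{0,1\}$ for $u \in C$ such that $$z_{u,\overrightarrow{C}} + \sum_{v \in N_{\overrightarrow{C}}(u)} x_{u,v} \ge 1 \quad \forall u \in C,$$ $$z_{u,\overrightarrow{C}} + x_{u,v} \le 1 \quad \forall u \in C,\ \forall v \in N_{\overrightarrow{C}}(u),$$ $$\sum_{u \in C} z_{u,\overrightarrow{C}} \le p.$$ Then there is no set $C' \subseteq C$ with $|C'| \ge p+1$ that is a clique in the graph $(C, E(C) \setminus \{e : x_e = 1\})$, i.e. no set $C'\subseteq C$ with $|C'|\ge p+1$ such that $x_e = 0$ for every edge $e$ with both endpoints in $C'$.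
   Context: $E(C)$ denotes the edge set of the subgraph induced by $C$. For a permutation (ordering) $\overrightarrow{C}$ of the vertices of the clique $C$, each edge of $E(C)$ is oriented from the endpoint that comes earlier in the ordering to the endpoint that comes later, yielding a tournament; $N_{\overrightarrow{C}}(u)$ denotes the set of out-neighbours of $u$ in this tournament, i.e. the vertices of $C$ that come after $u$ in the ordering. $x_{u,v}$ denotes $x_e$ for $e=\{u,v\}$. -}

module Defs where

open import Data.Nat using (ℕ; _+_; _≤_; suc)
open import Data.Fin using (Fin)
open import Data.List using (List; _∷_; _++_; map; length)
open import Data.Nat.ListAction using (sum)
open import Data.List.Membership.Propositional using (_∈_)
open import Data.List.Relation.Unary.Unique.Propositional using (Unique)
open import Data.Product using (_×_)
open import Relation.Binary.PropositionalEquality using (_≡_; _≢_)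
open import Relation.Nullary using (¬_)

record SimpleGraph (n : ℕ) : Set₁ where
  field
    Adj   : Fin n → Fin n → Set
    sym   : ∀ {u v} → Adj u v → Adj v u
    irrefl : ∀ {u} → ¬ Adj u u

open SimpleGraph public

IsClique : ∀ {n} → SimpleGraph n → List (Fin n) → Set
IsClique G C = Unique C × (∀ u v → u ∈ C → v ∈ C → u ≢ v → Adj G u v)

-- x ∈ {0,1}^{E(C)}, represented as a function on ordered pairs which is
-- symmetric and 0/1-valued on pairs of distinct vertices of C
-- (its values elsewhere are irrelevant).
IsEdgeVector : ∀ {n} → List (Fin n) → (Fin n → Fin n → ℕ) → Set
IsEdgeVector C x =
  (∀ u v → u ∈ C → v ∈ C → u ≢ v → x u v ≤ 1) ×
  (∀ u v → u ∈ C → v ∈ C → u ≢ v → x u v ≡ x v u)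

-- Writing π = pre ++ u ∷ post, the out-neighbours N_π(u) are exactly post.
-- z : Fin n → ℕ gives z_{u,π} for u ∈ C (values outside C irrelevant).
OrderingSystem : ∀ {n} → List (Fin n) → (Fin n → Fin n → ℕ) → ℕ →
                 List (Fin n) → (Fin n → ℕ) → Set
OrderingSystem C x p π z =
  (∀ u → u ∈ C → z u ≤ 1) ×
  (∀ pre u post → π ≡ pre ++ u ∷ post → 1 ≤ z u + sum (map (x u) post)) ×
  (∀ pre u post → π ≡ pre ++ u ∷ post → ∀ v → v ∈ post → z u + x u v ≤ 1) ×
  (sum (map z C) ≤ p)

UnblockedClique : ∀ {n} → List (Fin n) → (Fin n → Fin n → ℕ) → ℕ →
                  List (Fin n) → Set
UnblockedClique C x p C' =
  Unique C' × (∀ u → u ∈ C' → u ∈ C) × (suc p ≤ length C') ×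
  (∀ u v → u ∈ C' → v ∈ C' → u ≢ v → x u v ≡ 0)

-- Order C so that the unblocked clique C' comes last. Every u ∈ C' then has
-- all its out-neighbours inside C', where x vanishes, so the covering
-- constraint forces z u ≥ 1; summing, |C'| ≤ Σ_C z ≤ p < |C'|.

module Submission where

open import Defs using (SimpleGraph; IsClique; IsEdgeVector; OrderingSystem; UnblockedClique)
open import Data.Nat using (ℕ; _+_; _≤_; _<_; z≤n)
open import Data.Nat.Properties using (+-mono-≤; +-identityʳ; m≤n+m; <-irrefl; module ≤-Reasoning)
open import Data.Fin using (Fin)
open import Data.List using (List; []; _∷_; _++_; map; length; [_])
open import Data.List.Properties using (++-assoc; map-++)
open import Data.Nat.ListAction using (sum)
open import Data.Nat.ListAction.Properties using (sum-↭; sum-++)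
open import Data.List.Membership.Propositional using (_∈_)
open import Data.List.Membership.Propositional.Properties using (∈-∃++)
open import Data.List.Relation.Binary.Subset.Propositional using (_⊆_)
open import Data.List.Relation.Unary.Any using (here; there)
open import Data.List.Relation.Unary.All as All using (All; []; _∷_)
open import Data.List.Relation.Unary.AllPairs using ([]; _∷_)
open import Data.List.Relation.Unary.Unique.Propositional using (Unique)
open import Data.List.Relation.Binary.Permutation.Propositional using (_↭_; ↭-trans; ↭-sym; prep)
open import Data.List.Relation.Binary.Permutation.Propositional.Properties using (shift; ∈-resp-↭; ++-identityʳ; map⁺)
open import Data.Product using (∃; _,_)
open import Data.Empty using (⊥-elim)
open import Function using (_∘_)
open import Relation.Nullary using (¬_)
open import Relation.Binary.PropositionalEquality using (_≡_; _≢_; refl; sym; trans; cong; subst)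

module _ {a} {A : Set a} where

  ∈-∃↭ : ∀ {v : A} {xs} → v ∈ xs → ∃ λ ys → xs ↭ v ∷ ys
  ∈-∃↭ v∈xs with ys , zs , refl ← ∈-∃++ v∈xs = ys ++ zs , shift _ ys zs

  ⊆-∷⁻ : ∀ {y : A} {ys xs} → All (y ≢_) ys → ys ⊆ y ∷ xs → ys ⊆ xs
  ⊆-∷⁻ y∉ys ys⊆y∷xs v∈ys with ys⊆y∷xs v∈ys
  ... | here v≡y   = ⊥-elim (All.lookup y∉ys v∈ys (sym v≡y))
  ... | there v∈xs = v∈xs

  Unique-⊆⇒↭-suffix : ∀ {ys xs : List A} → Unique ys → ys ⊆ xs →
                      ∃ λ zs → zs ++ ys ↭ xs
  Unique-⊆⇒↭-suffix {[]}     {xs} _           _ = xs , ++-identityʳ xs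
  Unique-⊆⇒↭-suffix {y ∷ ys} {xs} (y∉ys ∷ ys!) y∷ys⊆xs
    with xs′ , xs↭y∷xs′ ← ∈-∃↭ (y∷ys⊆xs (here refl))
    with zs , zs++ys↭xs′ ← Unique-⊆⇒↭-suffix ys!
                             (⊆-∷⁻ y∉ys (∈-resp-↭ xs↭y∷xs′ ∘ y∷ys⊆xs ∘ there))
    = zs , ↭-trans (shift y zs ys) (↭-trans (prep y zs++ys↭xs′) (↭-sym xs↭y∷xs′))

  module _ (f : A → ℕ) where

    sum-map-≡0 : ∀ {xs} → All (λ v → f v ≡ 0) xs → sum (map f xs) ≡ 0
    sum-map-≡0 []           = refl
    sum-map-≡0 (fv≡0 ∷ all) rewrite fv≡0 = sum-map-≡0 all

    length≤sum-map : ∀ {xs} → All (λ v → 1 ≤ f v) xs → length xs ≤ sum (map f xs)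
    length≤sum-map []           = z≤n
    length≤sum-map (1≤fv ∷ all) = +-mono-≤ 1≤fv (length≤sum-map all)

    sum-map-suffix-≤ : ∀ xs ys → sum (map f ys) ≤ sum (map f (xs ++ ys))
    sum-map-suffix-≤ xs ys =
      subst (sum (map f ys) ≤_)
            (sym (trans (cong sum (map-++ f xs ys)) (sum-++ (map f xs) (map f ys))))
            (m≤n+m _ _)

  module _ (x : A → A → ℕ) (z : A → ℕ) {π : List A}
           (covered : ∀ pre u post → π ≡ pre ++ u ∷ post → 1 ≤ z u + sum (map (x u) post))
           where

    unblocked-suffix⇒z≥1 : ∀ pre s → π ≡ pre ++ s → Unique s →
                            (∀ u v → u ∈ s → v ∈ s → u ≢ v → x u v ≡ 0) →
                            All (λ u → 1 ≤ z u) s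
    unblocked-suffix⇒z≥1 pre []      _    _            _         = []
    unblocked-suffix⇒z≥1 pre (u ∷ s) π≡ (u∉s ∷ s!) unblocked =
      1≤zu ∷ unblocked-suffix⇒z≥1 (pre ++ [ u ]) s
               (trans π≡ (sym (++-assoc pre [ u ] s))) s!
               (λ v w v∈s w∈s → unblocked v w (there v∈s) (there w∈s))
      where
      out-sum≡0 : sum (map (x u) s) ≡ 0
      out-sum≡0 = sum-map-≡0 (x u)
        (All.tabulate λ v∈s → unblocked u _ (here refl) (there v∈s) (All.lookup u∉s v∈s))

      1≤zu : 1 ≤ z u
      1≤zu = subst (1 ≤_) (trans (cong (z u +_) out-sum≡0) (+-identityʳ (z u)))
                   (covered pre u s π≡)

lemma1 : ∀ {n} (G : SimpleGraph n) (C : List (Fin n)) (p : ℕ)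
    (x : Fin n → Fin n → ℕ) →
    IsClique G C → IsEdgeVector C x →
    (∀ π → π ↭ C → ∃ λ (z : Fin n → ℕ) → OrderingSystem C x p π z) →
    ¬ (∃ λ (C' : List (Fin n)) → UnblockedClique C x p C')
lemma1 G C p x _ _ system (C' , C'! , C'⊆C , p<|C'| , unblocked)
  with rest , rest++C'↭C ← Unique-⊆⇒↭-suffix C'! (λ {u} → C'⊆C u)
  with z , _ , covered , _ , Σz≤p ← system (rest ++ C') rest++C'↭C
  = <-irrefl refl p<p
  where
  open ≤-Reasoning
  p<p : p < p
  p<p = begin-strict
    p                          <⟨ p<|C'| ⟩
    length C'                  ≤⟨ length≤sum-map z
                                    (unblocked-suffix⇒z≥1 x z covered rest C' refl C'! unblocked) ⟩
    sum (map z C')             ≤⟨ sum-map-suffix-≤ z rest C' ⟩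
    sum (map z (rest ++ C'))   ≡⟨ sum-↭ (map⁺ z rest++C'↭C) ⟩
    sum (map z C)              ≤⟨ Σz≤p ⟩
    p                          ∎
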